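{- For every 2-sequent $\Gamma\vdash\Delta$: $2_{\mathsf{LTL}}$ derives $\Gamma\vdash\Delta$ if and only if $2^i_{\mathsf{LTL}}$ derives $\Gamma\vdash\Delta$.
   Context: Temporal formulas are built from proposition symbols using $\neg,\wedge,\vee,\to$ and the unary operators $\Box,\Diamond,\bigcirc$ (always, sometime, next). Positions are pairs $\langle n,S\rangle$ with $n\in\mathbb N$ and $S$ a finite set of tokens from a countably infinite set. For $s=\langle n,S\rangle$, $t=\langle m,T\rangle$: $s\oplus t=\langle n+m,S\cup T\rangle$; $s\oplus m$ means $s\oplus\langle m,\varnothing\rangle$; $s\oplus x$ means $s\oplus\langle 0,\{x\}\rangle$. A p-formula is $A^s$; a 2-sequent is $\Gamma\vdash\Delta$ with $\Gamma,\Delta$ finite (possibly empty) sequences of p-formulas; $x\notin s,\Gamma,\Delta$ means the token $x$ belongs to no position in $s,\Gamma,\Delta$. The calculus $2_{\mathsf{LTL}}$: Axiom $A^s\vdash A^s$; unrestricted Cut; weakening, contraction, exchange; classical propositional sequent rules for $\neg,\wedge,\vee,\to$ with all active p-formulas at the same position; temporal rules: from $\Gamma,A^{s\oplus t}\vdash\Delta$ infer $\Gamma,(\Box A)^s\vdash\Delta$ ($t$ any position); from $\Gamma\vdash A^{s\oplus x},\Delta$ infer $\Gamma\vdash(\Box A)^s,\Delta$; from $\Gamma,A^{s\oplus x}\vdash\Delta$ infer $\Gamma,(\Diamond A)^s\vdash\Delta$; from $\Gamma\vdash A^{s\oplus t},\Delta$ infer $\Gamma\vdash(\Diamond A)^s,\Delta$;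 from $\Gamma,A^{s\oplus 1}\vdash\Delta$ infer $\Gamma,(\bigcirc A)^s\vdash\Delta$; from $\Gamma\vdash A^{s\oplus1},\Delta$ infer $\Gamma\vdash(\bigcirc A)^s,\Delta$; IND: from $\Gamma,A^{s\oplus x}\vdash A^{s\oplus x\oplus 1},\Delta$ infer $\Gamma,A^s\vdash A^{s\oplus t},\Delta$ ($t$ any position). In the right $\Box$ rule, the left $\Diamond$ rule and IND, $x\notin s,\Gamma,\Delta$. The calculus $2^i_{\mathsf{LTL}}$ is obtained from $2_{\mathsf{LTL}}$ by removing the rule IND and adding, for every formula $A$ and every position $s$, the axiom $\vdash (A\wedge\Box(A\to\bigcirc A)\to\Box A)^s$. -}

module Defs where

open import Data.Nat using (ℕ; zero; suc; _+_; compare; less; equal; greater)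
open import Data.List using (List; []; _∷_; map; foldr; _++_; [_])
open import Data.List.Membership.Propositional using (_∈_)
open import Data.List.Relation.Unary.All using (All)
open import Data.Product using (_×_; _,_; proj₁; proj₂)
open import Data.Unit using (⊤)
open import Data.Empty using (⊥)
open import Relation.Nullary using (¬_)

infixr 6 _∧_
infixr 5 _∨_
infixr 4 _⇒_

data Formula : Set where
  atom        : ℕ → Formula
  ¬'_         : Formula → Formula
  _∧_ _∨_ _⇒_ : Formula → Formula → Formula
  □ ◇ ○       : Formula → Formula

-- A finite set of tokens is represented CANONICALLY by its "gap list":
-- the list [g₀, g₁, g₂, …] denotes the set
--   { g₀ , g₀ + 1 + g₁ , g₀ + 1 + g₁ + 1 + g₂ , … }.
-- Every list of naturals denotes exactly one finite set and every finite
-- set has exactly one gap list, so propositional equality on TokSet is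
-- equality of sets.

Token : Set
Token = ℕ

TokSet : Set
TokSet = List ℕ

elems : TokSet → List Token
elems []       = []
elems (g ∷ gs) = g ∷ map (λ y → suc (g + y)) (elems gs)

insert : Token → TokSet → TokSet
insert x []       = x ∷ []
insert x (g ∷ gs) with compare x g
... | less .x k    = x ∷ k ∷ gs
... | equal .x     = x ∷ gs
... | greater .g k = g ∷ insert k gs

∅ : TokSet
∅ = []

_∪_ : TokSet → TokSet → TokSet
S ∪ T = foldr insert T (elems S)

_∈ₛ_ : Token → TokSet → Set
x ∈ₛ S = x ∈ elems S

Pos : Set
Pos = ℕ × TokSet

infixl 7 _⊕_ _⊕ₙ_ _⊕ₓ_

_⊕_ : Pos → Pos → Pos
(n , S) ⊕ (m , T) = (n + m , S ∪ T)

_⊕ₙ_ : Pos → ℕ → Pos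
s ⊕ₙ m = s ⊕ (m , ∅)

_⊕ₓ_ : Pos → Token → Pos
s ⊕ₓ x = s ⊕ (0 , insert x ∅)

infix 8 _^_
record PFormula : Set where
  constructor _^_
  field
    formula  : Formula
    position : Pos
open PFormula public

Ctx : Set
Ctx = List PFormula

_∉pos_ : Token → Pos → Set
x ∉pos s = ¬ (x ∈ₛ proj₂ s)

_∉ctx_ : Token → Ctx → Set
x ∉ctx Γ = All (λ p → x ∉pos position p) Γ

-- The two calculi, as one inductive family indexed by the system.
--   LTL  : the calculus 2_LTL   (has the rule IND)
--   LTLi : the calculus 2^i_LTL (no IND; has the induction axioms)

data System : Set where
  LTL LTLi : System

HasIND : System → Set
HasIND LTL  = ⊤
HasIND LTLi = ⊥

HasIndAx : System → Set
HasIndAx LTL  = ⊥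
HasIndAx LTLi = ⊤

infix 3 _⊢[_]_

-- In a sequent Γ ⊢ Δ the list order is the sequence order; principal
-- p-formulas are written at the head of the list (exchange makes the
-- placement immaterial).
data _⊢[_]_ : Ctx → System → Ctx → Set where
  ax  : ∀ {σ A} → A ∷ [] ⊢[ σ ] A ∷ []
  cut : ∀ {σ Γ Δ A} → Γ ⊢[ σ ] A ∷ Δ → A ∷ Γ ⊢[ σ ] Δ → Γ ⊢[ σ ] Δ
  wL  : ∀ {σ Γ Δ A} → Γ ⊢[ σ ] Δ → A ∷ Γ ⊢[ σ ] Δ
  wR  : ∀ {σ Γ Δ A} → Γ ⊢[ σ ] Δ → Γ ⊢[ σ ] A ∷ Δ
  cL  : ∀ {σ Γ Δ A} → A ∷ A ∷ Γ ⊢[ σ ] Δ → A ∷ Γ ⊢[ σ ] Δ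
  cR  : ∀ {σ Γ Δ A} → Γ ⊢[ σ ] A ∷ A ∷ Δ → Γ ⊢[ σ ] A ∷ Δ
  eL  : ∀ {σ Γ₁ Γ₂ Δ A B} → Γ₁ ++ A ∷ B ∷ Γ₂ ⊢[ σ ] Δ → Γ₁ ++ B ∷ A ∷ Γ₂ ⊢[ σ ] Δ
  eR  : ∀ {σ Γ Δ₁ Δ₂ A B} → Γ ⊢[ σ ] Δ₁ ++ A ∷ B ∷ Δ₂ → Γ ⊢[ σ ] Δ₁ ++ B ∷ A ∷ Δ₂
  ¬L  : ∀ {σ Γ Δ A s} → Γ ⊢[ σ ] A ^ s ∷ Δ → (¬' A) ^ s ∷ Γ ⊢[ σ ] Δ
  ¬R  : ∀ {σ Γ Δ A s} → A ^ s ∷ Γ ⊢[ σ ] Δ → Γ ⊢[ σ ] (¬' A) ^ s ∷ Δ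
  ∧L₁ : ∀ {σ Γ Δ A B s} → A ^ s ∷ Γ ⊢[ σ ] Δ → (A ∧ B) ^ s ∷ Γ ⊢[ σ ] Δ
  ∧L₂ : ∀ {σ Γ Δ A B s} → B ^ s ∷ Γ ⊢[ σ ] Δ → (A ∧ B) ^ s ∷ Γ ⊢[ σ ] Δ
  ∧R  : ∀ {σ Γ Δ A B s} → Γ ⊢[ σ ] A ^ s ∷ Δ → Γ ⊢[ σ ] B ^ s ∷ Δ
      → Γ ⊢[ σ ] (A ∧ B) ^ s ∷ Δ
  ∨L  : ∀ {σ Γ Δ A B s} → A ^ s ∷ Γ ⊢[ σ ] Δ → B ^ s ∷ Γ ⊢[ σ ] Δ
      → (A ∨ B) ^ s ∷ Γ ⊢[ σ ] Δ
  ∨R₁ : ∀ {σ Γ Δ A B s} → Γ ⊢[ σ ] A ^ s ∷ Δ → Γ ⊢[ σ ] (A ∨ B) ^ s ∷ Δ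
  ∨R₂ : ∀ {σ Γ Δ A B s} → Γ ⊢[ σ ] B ^ s ∷ Δ → Γ ⊢[ σ ] (A ∨ B) ^ s ∷ Δ
  ⇒L  : ∀ {σ Γ Δ A B s} → Γ ⊢[ σ ] A ^ s ∷ Δ → B ^ s ∷ Γ ⊢[ σ ] Δ
      → (A ⇒ B) ^ s ∷ Γ ⊢[ σ ] Δ
  ⇒R  : ∀ {σ Γ Δ A B s} → A ^ s ∷ Γ ⊢[ σ ] B ^ s ∷ Δ → Γ ⊢[ σ ] (A ⇒ B) ^ s ∷ Δ
  □L  : ∀ {σ Γ Δ A s} (t : Pos) → A ^ (s ⊕ t) ∷ Γ ⊢[ σ ] Δ → (□ A) ^ s ∷ Γ ⊢[ σ ] Δ
  □R  : ∀ {σ Γ Δ A s} (x : Token) → x ∉pos s → x ∉ctx Γ → x ∉ctx Δ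
      → Γ ⊢[ σ ] A ^ (s ⊕ₓ x) ∷ Δ → Γ ⊢[ σ ] (□ A) ^ s ∷ Δ
  ◇L  : ∀ {σ Γ Δ A s} (x : Token) → x ∉pos s → x ∉ctx Γ → x ∉ctx Δ
      → A ^ (s ⊕ₓ x) ∷ Γ ⊢[ σ ] Δ → (◇ A) ^ s ∷ Γ ⊢[ σ ] Δ
  ◇R  : ∀ {σ Γ Δ A s} (t : Pos) → Γ ⊢[ σ ] A ^ (s ⊕ t) ∷ Δ → Γ ⊢[ σ ] (◇ A) ^ s ∷ Δ
  ○L  : ∀ {σ Γ Δ A s} → A ^ (s ⊕ₙ 1) ∷ Γ ⊢[ σ ] Δ → (○ A) ^ s ∷ Γ ⊢[ σ ] Δ
  ○R  : ∀ {σ Γ Δ A s} → Γ ⊢[ σ ] A ^ (s ⊕ₙ 1) ∷ Δ → Γ ⊢[ σ ] (○ A) ^ s ∷ Δ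
  IND : ∀ {σ Γ Δ A s} → HasIND σ → (t : Pos) (x : Token)
      → x ∉pos s → x ∉ctx Γ → x ∉ctx Δ
      → A ^ (s ⊕ₓ x) ∷ Γ ⊢[ σ ] A ^ (s ⊕ₓ x ⊕ₙ 1) ∷ Δ
      → A ^ s ∷ Γ ⊢[ σ ] A ^ (s ⊕ t) ∷ Δ
  indAx : ∀ {σ} → HasIndAx σ → (A : Formula) (s : Pos)
        → [] ⊢[ σ ] ((A ∧ □ (A ⇒ ○ A)) ⇒ □ A) ^ s ∷ []

module Submission where

-- Both calculi share every rule except the treatment of induction, so the
-- proof is a translation argument.  A single structural recursion
-- `translate` turns derivations of one system into derivations of another,
-- given only a way to simulate the two system-specific inferences (IND and
-- the induction axiom); every other rule is mapped to itself.
--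
--  * IND is admissible wherever the induction axioms are available
--    (`indFromAxiom`): from the IND premise, □R yields □(A → ○A)^s, and
--    cutting A ∧ □(A → ○A) against the axiom gives (□A)^s, whence A^(s⊕t).
--  * The induction axiom is derivable wherever IND is available
--    (`axiomFromInd`): IND at a token x fresh for s (`freshToken`) proves
--    A^(s⊕x) from A^s and □(A → ○A)^s, and □R concludes □A.

open import Defs
open import Function.Bundles using (_⇔_; mk⇔)
open import Data.Nat using (ℕ; suc; _+_; _<_; s≤s)
open import Data.Nat.Properties using (+-monoʳ-<; <-irrefl; m≤m+n)
open import Data.List using ([]; _∷_)
open import Data.List.Relation.Unary.All using ([]; _∷_)
open import Data.List.Relation.Unary.Any using (here; there)
open import Data.List.Membership.Propositional.Properties using (∈-map⁻)
open import Data.Product using (_,_; proj₂)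
open import Relation.Binary.PropositionalEquality using (refl)

weakenSecondR : ∀ {σ Γ X Y Δ} → Γ ⊢[ σ ] X ∷ Δ → Γ ⊢[ σ ] X ∷ Y ∷ Δ
weakenSecondR d = eR {Δ₁ = []} (wR d)

weakenSecondL : ∀ {σ Γ X Y Δ} → X ∷ Γ ⊢[ σ ] Δ → X ∷ Y ∷ Γ ⊢[ σ ] Δ
weakenSecondL d = eL {Γ₁ = []} (wL d)

weakenTailR : ∀ {σ Γ X} Δ → Γ ⊢[ σ ] X ∷ [] → Γ ⊢[ σ ] X ∷ Δ
weakenTailR []      d = d
weakenTailR (Y ∷ Δ) d = weakenSecondR (weakenTailR Δ d)

weakenTailL : ∀ {σ X Δ} Γ → X ∷ [] ⊢[ σ ] Δ → X ∷ Γ ⊢[ σ ] Δ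
weakenTailL []      d = d
weakenTailL (Y ∷ Γ) d = weakenSecondL (weakenTailL Γ d)

weakenAllL : ∀ {σ Δ} Γ → [] ⊢[ σ ] Δ → Γ ⊢[ σ ] Δ
weakenAllL []      d = d
weakenAllL (Y ∷ Γ) d = wL (weakenAllL Γ d)

identity : ∀ {σ P} Γ Δ → P ∷ Γ ⊢[ σ ] P ∷ Δ
identity Γ Δ = weakenTailL Γ (weakenTailR Δ ax)

record Simulation (σ τ : System) : Set where
  field
    simIND : ∀ {Γ Δ A s} → HasIND σ → (t : Pos) (x : Token)
           → x ∉pos s → x ∉ctx Γ → x ∉ctx Δ
           → A ^ (s ⊕ₓ x) ∷ Γ ⊢[ τ ] A ^ (s ⊕ₓ x ⊕ₙ 1) ∷ Δ
           → A ^ s ∷ Γ ⊢[ τ ] A ^ (s ⊕ t) ∷ Δ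
    simIndAx : HasIndAx σ → (A : Formula) (s : Pos)
             → [] ⊢[ τ ] ((A ∧ □ (A ⇒ ○ A)) ⇒ □ A) ^ s ∷ []
open Simulation

translate : ∀ {σ τ Γ Δ} → Simulation σ τ → Γ ⊢[ σ ] Δ → Γ ⊢[ τ ] Δ
translate S ax                   = ax
translate S (cut d e)            = cut (translate S d) (translate S e)
translate S (wL d)               = wL (translate S d)
translate S (wR d)               = wR (translate S d)
translate S (cL d)               = cL (translate S d)
translate S (cR d)               = cR (translate S d)
translate S (eL {Γ₁ = Γ₁} d)     = eL {Γ₁ = Γ₁} (translate S d)
translate S (eR {Δ₁ = Δ₁} d)     = eR {Δ₁ = Δ₁} (translate S d)
translate S (¬L d)               = ¬L (translate S d)
translate S (¬R d)               = ¬R (translate S d)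
translate S (∧L₁ d)              = ∧L₁ (translate S d)
translate S (∧L₂ d)              = ∧L₂ (translate S d)
translate S (∧R d e)             = ∧R (translate S d) (translate S e)
translate S (∨L d e)             = ∨L (translate S d) (translate S e)
translate S (∨R₁ d)              = ∨R₁ (translate S d)
translate S (∨R₂ d)              = ∨R₂ (translate S d)
translate S (⇒L d e)             = ⇒L (translate S d) (translate S e)
translate S (⇒R d)               = ⇒R (translate S d)
translate S (□L t d)             = □L t (translate S d)
translate S (□R x xs xΓ xΔ d)    = □R x xs xΓ xΔ (translate S d)
translate S (◇L x xs xΓ xΔ d)    = ◇L x xs xΓ xΔ (translate S d)
translate S (◇R t d)             = ◇R t (translate S d)
translate S (○L d)               = ○L (translate S d)
translate S (○R d)               = ○R (translate S d)
translate S (IND h t x xs xΓ xΔ d) = simIND S h t x xs xΓ xΔ (translate S d)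
translate S (indAx h A s)        = simIndAx S h A s

indFromAxiom : ∀ {σ Γ Δ A s} → HasIndAx σ → (t : Pos) (x : Token)
             → x ∉pos s → x ∉ctx Γ → x ∉ctx Δ
             → A ^ (s ⊕ₓ x) ∷ Γ ⊢[ σ ] A ^ (s ⊕ₓ x ⊕ₙ 1) ∷ Δ
             → A ^ s ∷ Γ ⊢[ σ ] A ^ (s ⊕ t) ∷ Δ
indFromAxiom {σ} {Γ} {Δ} {A} {s} h t x xs xΓ xΔ d =
  cut (weakenSecondR always) (□L t (identity (A ^ s ∷ Γ) Δ))
  where
  stepEverywhere : Γ ⊢[ σ ] (□ (A ⇒ ○ A)) ^ s ∷ Δ
  stepEverywhere = □R x xs xΓ xΔ (⇒R (○R d))

  hypothesis : A ^ s ∷ Γ ⊢[ σ ] (A ∧ □ (A ⇒ ○ A)) ^ s ∷ Δ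
  hypothesis = ∧R (identity Γ Δ) (wL stepEverywhere)

  -- modus ponens with the induction axiom
  always : A ^ s ∷ Γ ⊢[ σ ] (□ A) ^ s ∷ Δ
  always = cut (weakenAllL (A ^ s ∷ Γ) (weakenTailR ((□ A) ^ s ∷ Δ) (indAx h A s)))
               (⇒L (weakenSecondR hypothesis) (identity (A ^ s ∷ Γ) Δ))

-- An upper bound for a token set: one more than its largest element.
tokenBound : TokSet → ℕ
tokenBound []       = 0
tokenBound (g ∷ gs) = suc (g + tokenBound gs)

elems<tokenBound : ∀ S y → y ∈ₛ S → y < tokenBound S
elems<tokenBound (g ∷ gs) y (here refl) = s≤s (m≤m+n g (tokenBound gs))
elems<tokenBound (g ∷ gs) y (there p) with ∈-map⁻ (λ z → suc (g + z)) p
... | z , z∈gs , refl = s≤s (+-monoʳ-< g (elems<tokenBound gs z z∈gs))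

freshToken : (s : Pos) → tokenBound (proj₂ s) ∉pos s
freshToken s p = <-irrefl refl (elems<tokenBound (proj₂ s) _ p)

axiomFromInd : ∀ {σ} → HasIND σ → (A : Formula) (s : Pos)
             → [] ⊢[ σ ] ((A ∧ □ (A ⇒ ○ A)) ⇒ □ A) ^ s ∷ []
axiomFromInd {σ} h A s =
  ⇒R (cL (∧L₁ (eL {Γ₁ = []} (∧L₂ (□R x x∉s (x∉s ∷ x∉s ∷ []) [] reachesX)))))
  where
  x : Token
  x = tokenBound (proj₂ s)

  x∉s : x ∉pos s
  x∉s = freshToken s

  step : A ^ (s ⊕ₓ x) ∷ (□ (A ⇒ ○ A)) ^ s ∷ [] ⊢[ σ ] A ^ (s ⊕ₓ x ⊕ₙ 1) ∷ []
  step = eL {Γ₁ = []} (□L (0 , insert x ∅) (⇒L (identity [] _) (○L (identity _ []))))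

  -- IND with eigen-token x and target t = ⟨0, {x}⟩, so that s ⊕ t = s ⊕ x
  reachesX : (□ (A ⇒ ○ A)) ^ s ∷ A ^ s ∷ [] ⊢[ σ ] A ^ (s ⊕ₓ x) ∷ []
  reachesX = eL {Γ₁ = []} (IND h (0 , insert x ∅) x x∉s (x∉s ∷ []) [] step)

indToAxiom : Simulation LTL LTLi
indToAxiom = record { simIND = λ _ → indFromAxiom _ ; simIndAx = λ () }

axiomToInd : Simulation LTLi LTL
axiomToInd = record { simIND = λ () ; simIndAx = λ _ → axiomFromInd _ }

mainTheorem16 : (Γ Δ : Ctx) → (Γ ⊢[ LTL ] Δ) ⇔ (Γ ⊢[ LTLi ] Δ)
mainTheorem16 Γ Δ = mk⇔ (translate indToAxiom) (translate axiomToInd)
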